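{- Let $H$ be a marked hypergraph that is not a trivial Maker win, with $|V(H)\setminus M(H)|\ge2$, and suppose that $J_1(\mathcal D_0,H)$ holds. Then for every $m\in M(H)$, $H$ contains no $m$-tadpole and no $m$-snake.
   Context: A marked hypergraph $H$: finite nonempty $V(H)$, edge set $E(H)$ of nonempty subsets of $V(H)$, marked set $M(H)\subseteq V(H)$. Subhypergraph $X$: $V(X)\subseteq V(H)$, $E(X)\subseteq E(H)$, $M(X)=V(X)\cap M(H)$; "contains" means as a subhypergraph. $H^{+x}$ marks non-marked $x$. Trivial Maker win: some edge $e$ with $|e\setminus M(H)|\le1$. $ab$-path of length 0: the vertex $a=b$; of length $L\ge1$: edges $e_1,\dots,e_L$ (3-sets), vertex set $\bigcup e_i$, $|e_i\cap e_{i+1}|=1$, $e_i\cap e_j=\varnothing$ for $|i-j|\ge2$, $a\ne b$, $a\in e_1\setminus\bigcup_{i\ge2}e_i$, $b\in e_L\setminus\bigcup_{i<L}e_i$. $a$-cycle of length $L\ge2$: edges $e_1,\dots,e_L$, vertex set $\bigcup e_i$, $a\in e_1\cap e_L$, $a\notin e_i$ for $1<i<L$; if $L=2$, $|e_1\cap e_2|=2$; if $L\ge3$, $|e_i\cap e_{i+1}|=1$, $e_1\cap e_L=\{a\}$, other pairs with $|i-j|\ge2$ disjoint. $a$-tadpole: union of an $ab$-path $P$ (possibly length 0) and a $b$-cycle $C$ with $V(P)\cap V(C)=\{b\}$. $a$-snake: an $am'$-path of positive length with $m'$ marked. Pointed $(D,x)$: $x\in V(D)\setminus M(D)$; isomorphism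 preserves edges, marks, point. $x\mathcal F(H)$: subhypergraphs $X\ni x$ of $H$ with $(X,x)$ isomorphic to a member of $\mathcal F$. $\mathrm{Int}_H(\mathcal X)$: non-marked vertices of $H$ in every member of $\mathcal X$. $J_1(\mathcal F,H)$: for every non-marked $x$, $\mathrm{Int}_{H^{+x}}(x\mathcal F(H))\ne\varnothing$. $\mathcal S$: $(S,x)$ with $S$ an $x$-snake with exactly one marked vertex; $\mathcal C$: $(C,x)$ with $C$ an $x$-cycle with no marked vertex; $\mathcal D_0=\mathcal S\cup\mathcal C$. -}

module Defs where

open import Data.Nat using (ℕ; zero; suc; _≤_; _+_)
open import Data.Fin using (Fin; toℕ)
open import Data.Fin.Subset using (Subset; _∈_; _∉_; _∩_; _─_; ∁; ∣_∣; Nonempty; Empty)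
open import Data.List using (List)
open import Data.List.Relation.Unary.All using (All)
open import Data.List.Membership.Propositional using () renaming (_∈_ to _∈L_)
open import Data.Product using (Σ; ∃; ∃-syntax; _×_; _,_)
open import Data.Sum using (_⊎_)
open import Relation.Binary.PropositionalEquality using (_≡_; _≢_)
open import Relation.Nullary using (¬_)

record MarkedHypergraph (n : ℕ) : Set where
  field
    edges    : List (Subset n)
    nonempty : All Nonempty edges
    marked   : Subset n
open MarkedHypergraph public

module _ {n : ℕ} (H : MarkedHypergraph n) where

  TrivialMakerWin : Set
  TrivialMakerWin = ∃[ e ] (e ∈L edges H × ∣ e ─ marked H ∣ ≤ 1)

  _∈V_ : ∀ {L} → Fin n → (Fin L → Subset n) → Set
  v ∈V es = ∃[ i ] (v ∈ es i)

  -- The edges es form an ab-path of positive length L in H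
  -- (indices shifted: e_{i+1} = es i).
  IsPath : ∀ {L} → Fin n → Fin n → (Fin L → Subset n) → Set
  IsPath {L} a b es =
      (∀ i → es i ∈L edges H)
    × (∀ i → ∣ es i ∣ ≡ 3)
    × (∀ i j → suc (toℕ i) ≡ toℕ j → ∣ es i ∩ es j ∣ ≡ 1)
    × (∀ i j → 2 + toℕ i ≤ toℕ j → Empty (es i ∩ es j))
    × a ≢ b
    × (∃[ i ] (a ∈ es i)) × (∀ i → a ∈ es i → toℕ i ≡ 0)
    × (∃[ i ] (b ∈ es i)) × (∀ i → b ∈ es i → suc (toℕ i) ≡ L)

  IsCycle : ∀ {L} → Fin n → (Fin L → Subset n) → Set
  IsCycle {L} a es =
      2 ≤ L
    × (∀ i → es i ∈L edges H)
    × (∀ i → ∣ es i ∣ ≡ 3)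
    × (∀ i → toℕ i ≡ 0 → a ∈ es i)
    × (∀ i → suc (toℕ i) ≡ L → a ∈ es i)
    × (∀ i → a ∈ es i → toℕ i ≡ 0 ⊎ suc (toℕ i) ≡ L)
    × (L ≡ 2 → ∀ i j → toℕ i ≡ 0 → toℕ j ≡ 1 → ∣ es i ∩ es j ∣ ≡ 2)
    × (3 ≤ L →
          (∀ i j → suc (toℕ i) ≡ toℕ j → ∣ es i ∩ es j ∣ ≡ 1)
        × (∀ i j → toℕ i ≡ 0 → suc (toℕ j) ≡ L →
              ∀ v → v ∈ es i → v ∈ es j → v ≡ a)
        × (∀ i j → 2 + toℕ i ≤ toℕ j → ¬ (toℕ i ≡ 0 × suc (toℕ j) ≡ L) →
              Empty (es i ∩ es j)))

  -- H contains an a-tadpole: an ab-path P (possibly of length 0, i.e. a = b)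
  -- together with a b-cycle C with V(P) ∩ V(C) = {b}.
  ContainsTadpole : Fin n → Set
  ContainsTadpole a =
    ∃[ b ] ∃[ L ] Σ (Fin L → Subset n) λ cs → IsCycle b cs ×
      ( a ≡ b
      ⊎ (∃[ K ] Σ (Fin K → Subset n) λ ps → IsPath a b ps ×
           (∀ v → v ∈V ps → v ∈V cs → v ≡ b)))

  ContainsSnake : Fin n → Set
  ContainsSnake a =
    ∃[ m' ] m' ∈ marked H × (∃[ L ] Σ (Fin L → Subset n) λ ps → IsPath a m' ps)

  -- Membership of the subhypergraph with edge family es in x𝒟₀(H):
  -- an x-snake with exactly one marked vertex, or an x-cycle with no marked vertex.
  InXD0 : ∀ {L} → Fin n → (Fin L → Subset n) → Set
  InXD0 x es =
      (∃[ m' ] IsPath x m' es × m' ∈ marked H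
          × (∀ v → v ∈V es → v ∈ marked H → v ≡ m'))
    ⊎ (IsCycle x es × (∀ v → v ∈V es → v ∉ marked H))

  -- J₁(𝒟₀, H): for every non-marked x, some vertex that is non-marked in H^{+x}
  -- (i.e. y ∉ M(H), y ≠ x) lies in every member of x𝒟₀(H).
  J1D0 : Set
  J1D0 = ∀ x → x ∉ marked H →
    ∃[ y ] (y ∉ marked H × y ≢ x ×
      (∀ {L} (es : Fin L → Subset n) → InXD0 x es → y ∈V es))

-- A marked end of a tadpole or a snake yields an unmarked vertex x and two paths leaving x,
-- each reaching a marked vertex, whose common vertices are x or marked. Since H is not a
-- trivial Maker win, no edge holds two marked vertices, so truncating each path at its first
-- marked vertex gives an x-snake with exactly one marked vertex. J₁(𝒟₀, H) then asks for an
-- unmarked vertex y ≠ x lying on both snakes, which is impossible. In the one remaining case,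
-- a tadpole whose junction b and whose cycle are unmarked, the cycle itself is a member of
-- b𝒟₀(H) and takes the place of the second snake.
module Submission where

open import Defs
open import Data.Nat using (_≤_)
open import Data.Fin.Subset using (_∈_; ∁; ∣_∣)
open import Data.Product using (_×_)
open import Relation.Nullary using (¬_)

open import Data.Empty using (⊥; ⊥-elim)
open import Data.Fin using (Fin; zero; suc; toℕ; inject₁; inject≤; opposite; fromℕ; _≟_)
open import Data.Fin.Properties
  using (toℕ<n; toℕ-injective; toℕ-inject≤; toℕ-inject₁; toℕ-inject₁-≢; toℕ-fromℕ;
         opposite-prop; opposite-involutive; any?)
open import Data.Fin.Relation.Unary.Top using (view; ‵fromℕ; ‵inject₁)
open import Data.Fin.Subset using (Subset; _∉_; _∩_; _─_; _-_; ⁅_⁆; Nonempty; Empty; _⊆_; outside)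
open import Data.Fin.Subset.Properties
  using (_∈?_; nonempty?; Empty-unique; ∣⊥∣≡0; ∣⁅x⁆∣≡1; x∈⁅x⁆; x∉⁅y⁆⇒x≢y; p⊆q⇒∣p∣≤∣q∣;
         p─q⊆p; x∈p∧x≢y⇒x∈p-y; x∈p⇒∣p-x∣<∣p∣; x∈p∩q⁺; x∈p∩q⁻; ∩-comm)
open import Data.List.Membership.Propositional using () renaming (_∈_ to _∈L_)
open import Data.Nat using (ℕ; zero; suc; _<_; _+_; z≤n; s≤s) renaming (_≟_ to _ℕ≟_)
open import Data.Nat.Properties
  using (≤-pred; ≤-trans; ≤-reflexive; <⇒≱; m≤n⇒m<n∨m≡n; +-suc; +-comm; +-cancelˡ-≡;
         +-cancelʳ-≡; +-cancelʳ-≤; +-monoʳ-≤; m∸n+n≡m; suc-injective; module ≤-Reasoning)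
open import Data.Product using (Σ; ∃; ∃-syntax; _,_; proj₁; proj₂)
open import Data.Sum using (_⊎_; inj₁; inj₂; [_,_]; map₂)
open import Data.Vec using (_∷_; here; there)
open import Function using (_∘_; case_of_)
open import Relation.Binary.PropositionalEquality
  using (_≡_; _≢_; refl; sym; trans; cong; subst; module ≡-Reasoning)
open import Relation.Nullary using (Dec; yes; no; contradiction)

x∈p─q⇒x∉q : ∀ {n} {x : Fin n} {p q} → x ∈ p ─ q → x ∉ q
x∈p─q⇒x∉q {p = _ ∷ p} {outside ∷ q} here ()
x∈p─q⇒x∉q {p = _ ∷ p} {_ ∷ q} (there x∈p─q) (there x∈q) = x∈p─q⇒x∉q {p = p} {q} x∈p─q x∈q

module _ {n : ℕ} where

  x∈p⇒0<∣p∣ : ∀ {x : Fin n} {p} → x ∈ p → 0 < ∣ p ∣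
  x∈p⇒0<∣p∣ x∈p = ≤-trans (s≤s z≤n) (x∈p⇒∣p-x∣<∣p∣ x∈p)

  0<∣p∣⇒Nonempty : ∀ {p : Subset n} → 0 < ∣ p ∣ → Nonempty p
  0<∣p∣⇒Nonempty {p} 0<∣p∣ with nonempty? p
  ... | yes ne = ne
  ... | no ¬ne = contradiction (subst (0 <_) (trans (cong ∣_∣ (Empty-unique ¬ne)) (∣⊥∣≡0 n)) 0<∣p∣) λ ()

  ∣p∣≤1⇒x≡y : ∀ {p : Subset n} {x y} → ∣ p ∣ ≤ 1 → x ∈ p → y ∈ p → x ≡ y
  ∣p∣≤1⇒x≡y {x = x} {y} ∣p∣≤1 x∈p y∈p with x ≟ y
  ... | yes x≡y = x≡y
  ... | no x≢y = contradiction ∣p∣≤1 (<⇒≱ (≤-trans (s≤s (x∈p⇒0<∣p∣ y∈p-x)) (x∈p⇒∣p-x∣<∣p∣ x∈p)))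
    where
    y∈p-x = x∈p∧x≢y⇒x∈p-y y∈p (x≢y ∘ sym)

  1<∣p∣⇒∃≢ : ∀ {p : Subset n} {x} → 1 < ∣ p ∣ → ∃[ y ] (y ∈ p × y ≢ x)
  1<∣p∣⇒∃≢ {p} {x} 1<∣p∣ with nonempty? (p - x)
  ... | yes (y , y∈p-x) = y , p─q⊆p p ⁅ x ⁆ y∈p-x , x∉⁅y⁆⇒x≢y (x∈p─q⇒x∉q y∈p-x)
  ... | no ¬ne = contradiction (subst (∣ p ∣ ≤_) (∣⁅x⁆∣≡1 x) (p⊆q⇒∣p∣≤∣q∣ p⊆⁅x⁆)) (<⇒≱ 1<∣p∣)
    where
    p⊆⁅x⁆ : p ⊆ ⁅ x ⁆
    p⊆⁅x⁆ {y} y∈p with y ≟ x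
    ... | yes refl = x∈⁅x⁆ x
    ... | no y≢x = contradiction (y , x∈p∧x≢y⇒x∈p-y y∈p y≢x) ¬ne

  ∣p∣≤2⇒≡⊎≡ : ∀ {p : Subset n} {x y z} → ∣ p ∣ ≤ 2 → x ∈ p → y ∈ p → x ≢ y → z ∈ p → z ≡ x ⊎ z ≡ y
  ∣p∣≤2⇒≡⊎≡ {p} {x} {y} {z} ∣p∣≤2 x∈p y∈p x≢y z∈p with z ≟ x
  ... | yes z≡x = inj₁ z≡x
  ... | no z≢x = inj₂ (∣p∣≤1⇒x≡y ∣p-x∣≤1 (x∈p∧x≢y⇒x∈p-y z∈p z≢x) (x∈p∧x≢y⇒x∈p-y y∈p (x≢y ∘ sym)))
    where
    ∣p-x∣≤1 : ∣ p - x ∣ ≤ 1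
    ∣p-x∣≤1 = ≤-pred (≤-trans (x∈p⇒∣p-x∣<∣p∣ x∈p) ∣p∣≤2)

  2+∣p─q∣≤∣p∣ : ∀ {p q : Subset n} {u v} → u ≢ v → u ∈ p → v ∈ p → u ∈ q → v ∈ q → 2 + ∣ p ─ q ∣ ≤ ∣ p ∣
  2+∣p─q∣≤∣p∣ {p} {q} {u} {v} u≢v u∈p v∈p u∈q v∈q = begin
    2 + ∣ p ─ q ∣      ≤⟨ s≤s (s≤s (p⊆q⇒∣p∣≤∣q∣ p─q⊆p-u-v)) ⟩
    2 + ∣ p - u - v ∣  ≤⟨ s≤s (x∈p⇒∣p-x∣<∣p∣ v∈p-u) ⟩
    suc ∣ p - u ∣      ≤⟨ x∈p⇒∣p-x∣<∣p∣ u∈p ⟩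
    ∣ p ∣              ∎
    where
    open ≤-Reasoning
    v∈p-u : v ∈ p - u
    v∈p-u = x∈p∧x≢y⇒x∈p-y v∈p (u≢v ∘ sym)
    p─q⊆p-u-v : p ─ q ⊆ p - u - v
    p─q⊆p-u-v w∈p─q = x∈p∧x≢y⇒x∈p-y (x∈p∧x≢y⇒x∈p-y (p─q⊆p p q w∈p─q) (λ { refl → x∈p─q⇒x∉q w∈p─q u∈q }))
                                    (λ { refl → x∈p─q⇒x∉q w∈p─q v∈q })

least-witness : ∀ {L} {P : Fin L → Set} → (∀ i → Dec (P i)) → ∃ P →
  ∃[ i ] (P i × (∀ j → toℕ j < toℕ i → ¬ P j))
least-witness {suc L} P? (i , Pi) with P? zero
... | yes P0 = zero , P0 , λ _ ()
least-witness {suc L} P? (zero , P0) | no ¬P0 = contradiction P0 ¬P0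
least-witness {suc L} P? (suc i , Pi) | no ¬P0 with least-witness (P? ∘ suc) (i , Pi)
... | k , Pk , below = suc k , Pk , λ { zero _ → ¬P0 ; (suc j) j<k → below j (≤-pred j<k) }

prefix-index : ∀ {L} (i : Fin L) (j : Fin (suc (toℕ i))) →
  toℕ (inject≤ j (toℕ<n i)) < toℕ i ⊎ inject≤ j (toℕ<n i) ≡ i
prefix-index i j with m≤n⇒m<n∨m≡n (≤-pred (toℕ<n j))
... | inj₁ j<i = inj₁ (subst (_< toℕ i) (sym (toℕ-inject≤ j _)) j<i)
... | inj₂ j≡i = inj₂ (toℕ-injective (trans (toℕ-inject≤ j _) j≡i))

toℕ-opposite+suc : ∀ {L} (i : Fin L) → toℕ (opposite i) + suc (toℕ i) ≡ L
toℕ-opposite+suc i = trans (cong (_+ suc (toℕ i)) (opposite-prop i)) (m∸n+n≡m (toℕ<n i))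

module _ {K L : ℕ} {f : Fin K → Fin L} {i j : Fin K} where

  shift-adjacent : ∀ c → (∀ k → toℕ (f k) ≡ c + toℕ k) →
    suc (toℕ i) ≡ toℕ j → suc (toℕ (f i)) ≡ toℕ (f j)
  shift-adjacent c f≡ i+1≡j = begin
    suc (toℕ (f i))  ≡⟨ cong suc (f≡ i) ⟩
    suc (c + toℕ i)  ≡⟨ +-suc c (toℕ i) ⟨
    c + suc (toℕ i)  ≡⟨ cong (c +_) i+1≡j ⟩
    c + toℕ j        ≡⟨ f≡ j ⟨
    toℕ (f j)        ∎
    where open ≡-Reasoning

  shift-distant : ∀ c → (∀ k → toℕ (f k) ≡ c + toℕ k) →
    2 + toℕ i ≤ toℕ j → 2 + toℕ (f i) ≤ toℕ (f j)
  shift-distant c f≡ i+2≤j = begin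
    2 + toℕ (f i)      ≡⟨ cong (2 +_) (f≡ i) ⟩
    2 + (c + toℕ i)    ≡⟨ trans (+-suc c _) (cong suc (+-suc c _)) ⟨
    c + (2 + toℕ i)    ≤⟨ +-monoʳ-≤ c i+2≤j ⟩
    c + toℕ j          ≡⟨ f≡ j ⟨
    toℕ (f j)          ∎
    where open ≤-Reasoning

  reflect-adjacent : ∀ c → (∀ k → toℕ (f k) + suc (toℕ k) ≡ c) →
    suc (toℕ i) ≡ toℕ j → suc (toℕ (f j)) ≡ toℕ (f i)
  reflect-adjacent c f≡ i+1≡j = +-cancelʳ-≡ (suc (toℕ i)) _ _ (begin
    suc (toℕ (f j)) + suc (toℕ i)  ≡⟨ +-suc (toℕ (f j)) (suc (toℕ i)) ⟨
    toℕ (f j) + suc (suc (toℕ i))  ≡⟨ cong (λ k → toℕ (f j) + suc k) i+1≡j ⟩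
    toℕ (f j) + suc (toℕ j)        ≡⟨ trans (f≡ j) (sym (f≡ i)) ⟩
    toℕ (f i) + suc (toℕ i)        ∎)
    where open ≡-Reasoning

  reflect-distant : ∀ c → (∀ k → toℕ (f k) + suc (toℕ k) ≡ c) →
    2 + toℕ i ≤ toℕ j → 2 + toℕ (f j) ≤ toℕ (f i)
  reflect-distant c f≡ i+2≤j = +-cancelʳ-≤ (suc (toℕ i)) _ _ (begin
    2 + toℕ (f j) + suc (toℕ i)  ≡⟨ trans (+-suc (toℕ (f j)) _) (cong suc (+-suc (toℕ (f j)) _)) ⟨
    toℕ (f j) + suc (2 + toℕ i)  ≤⟨ +-monoʳ-≤ (toℕ (f j)) (s≤s i+2≤j) ⟩
    toℕ (f j) + suc (toℕ j)      ≡⟨ trans (f≡ j) (sym (f≡ i)) ⟩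
    toℕ (f i) + suc (toℕ i)      ∎)
    where open ≤-Reasoning

module _ {n : ℕ} (H : MarkedHypergraph n) where

  private
    M : Subset n
    M = marked H

  _∈⋃_ : ∀ {L} → Fin n → (Fin L → Subset n) → Set
  v ∈⋃ es = _∈V_ H v es

  ⋃-reverse⁺ : ∀ {L v} {es : Fin L → Subset n} → v ∈⋃ es → v ∈⋃ (es ∘ opposite)
  ⋃-reverse⁺ {v = v} {es} (i , v∈) = opposite i , subst (λ k → v ∈ es k) (sym (opposite-involutive i)) v∈

  MeetsMarked : ∀ {L} → (Fin L → Subset n) → Set
  MeetsMarked es = ∃[ i ] Nonempty (es i ∩ M)

  meetsMarked? : ∀ {L} (es : Fin L → Subset n) → Dec (MeetsMarked es)
  meetsMarked? es = any? (λ i → nonempty? (es i ∩ M))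

  SeparatedAt : ∀ {K L} → Fin n → (Fin K → Subset n) → (Fin L → Subset n) → Set
  SeparatedAt x ps qs = ∀ v → v ∈⋃ ps → v ∈⋃ qs → v ≡ x ⊎ v ∈ M

  ContainsD₀Member : ∀ {L} → Fin n → (Fin L → Subset n) → Set
  ContainsD₀Member x es =
    ∃[ k ] Σ (Fin k → Subset n) λ ds → InXD0 H x ds × (∀ v → v ∈⋃ ds → v ∈⋃ es)

  record IsChain {L} (es : Fin L → Subset n) : Set where
    constructor mkChain
    field
      inH      : ∀ i → es i ∈L edges H
      triple   : ∀ i → ∣ es i ∣ ≡ 3
      adjacent : ∀ i j → suc (toℕ i) ≡ toℕ j → ∣ es i ∩ es j ∣ ≡ 1
      distant  : ∀ i j → 2 + toℕ i ≤ toℕ j → Empty (es i ∩ es j)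
  open IsChain

  record IsPathFrom {L} (x : Fin n) (es : Fin L → Subset n) : Set where
    constructor mkPathFrom
    field
      chain   : IsChain es
      starts  : ∃[ i ] x ∈ es i
      initial : ∀ i → x ∈ es i → toℕ i ≡ 0
  open IsPathFrom

  IsChain-shift : ∀ {K L} {es : Fin L → Subset n} c (f : Fin K → Fin L) →
    (∀ k → toℕ (f k) ≡ c + toℕ k) → IsChain es → IsChain (es ∘ f)
  IsChain-shift c f f≡ ch = mkChain (inH ch ∘ f) (triple ch ∘ f)
    (λ i j → adjacent ch (f i) (f j) ∘ shift-adjacent c f≡)
    (λ i j → distant ch (f i) (f j) ∘ shift-distant c f≡)

  IsChain-reflect : ∀ {K L} {es : Fin L → Subset n} c (f : Fin K → Fin L) →
    (∀ k → toℕ (f k) + suc (toℕ k) ≡ c) → IsChain es → IsChain (es ∘ f)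
  IsChain-reflect {es = es} c f f≡ ch = mkChain (inH ch ∘ f) (triple ch ∘ f)
    (λ i j i+1≡j → trans (cong ∣_∣ (∩-comm (es (f i)) (es (f j))))
                         (adjacent ch (f j) (f i) (reflect-adjacent c f≡ i+1≡j)))
    (λ i j i+2≤j (v , v∈) → distant ch (f j) (f i) (reflect-distant c f≡ i+2≤j)
                              (v , subst (v ∈_) (∩-comm (es (f i)) (es (f j))) v∈))

  single-edge-path : ∀ {x} {es : Fin 1 → Subset n} →
    es zero ∈L edges H → ∣ es zero ∣ ≡ 3 → x ∈ es zero → IsPathFrom x es
  single-edge-path e∈H ∣e∣≡3 x∈e = mkPathFrom
    (mkChain (λ { zero → e∈H }) (λ { zero → ∣e∣≡3 }) (λ { zero zero () }) (λ { zero zero () }))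
    (zero , x∈e) (λ { zero _ → refl })

  IsPath⇒IsChain : ∀ {L a b} {es : Fin L → Subset n} → IsPath H a b es → IsChain es
  IsPath⇒IsChain (inH , triple , adjacent , distant , _) = mkChain inH triple adjacent distant

  IsPath-reverse : ∀ {L a b} {es : Fin L → Subset n} → IsPath H a b es → IsPathFrom b (es ∘ opposite)
  IsPath-reverse {L} path@(_ , _ , _ , _ , _ , _ , _ , (i , b∈) , final) = mkPathFrom
    (IsChain-reflect L opposite toℕ-opposite+suc (IsPath⇒IsChain path))
    (⋃-reverse⁺ (i , b∈))
    (λ j b∈ → suc-injective (+-cancelˡ-≡ (toℕ (opposite j)) _ _
                (trans (toℕ-opposite+suc j) (trans (sym (final (opposite j) b∈)) (+-comm 1 _)))))

  prefix : ∀ {L} → (Fin L → Subset n) → (i : Fin L) → Fin (suc (toℕ i)) → Subset n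
  prefix es i j = es (inject≤ j (toℕ<n i))

  prefix-path : ∀ {L x w} {es : Fin L → Subset n} → IsPathFrom x es → (i : Fin L) →
    w ∈ es i → (∀ j → toℕ j < toℕ i → w ∉ es j) → x ≢ w → IsPath H x w (prefix es i)
  prefix-path {x = x} {w} {es} (mkPathFrom ch (i₀ , x∈) initial) i w∈ earlier x≢w =
    inH ch′ , triple ch′ , adjacent ch′ , distant ch′ , x≢w ,
    (zero , subst (λ k → x ∈ es k) i₀≡first x∈) ,
    (λ j x∈ → trans (sym (toℕ-inject≤ j _)) (initial _ x∈)) ,
    (fromℕ (toℕ i) , subst (λ k → w ∈ es k) (sym last≡i) w∈) ,
    (λ j w∈ → cong suc (at-end j w∈))
    where
    ch′ : IsChain (prefix es i)
    ch′ = IsChain-shift 0 (λ j → inject≤ j (toℕ<n i)) (λ j → toℕ-inject≤ j _) ch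
    i₀≡first : i₀ ≡ inject≤ zero (toℕ<n i)
    i₀≡first = toℕ-injective (trans (initial i₀ x∈) (sym (toℕ-inject≤ zero _)))
    last≡i : inject≤ (fromℕ (toℕ i)) (toℕ<n i) ≡ i
    last≡i = toℕ-injective (trans (toℕ-inject≤ _ _) (toℕ-fromℕ _))
    at-end : ∀ j → w ∈ prefix es i j → toℕ j ≡ toℕ i
    at-end j w∈ with prefix-index i j
    ... | inj₁ j<i = contradiction w∈ (earlier _ j<i)
    ... | inj₂ j≡i = trans (sym (toℕ-inject≤ j _)) (cong toℕ j≡i)

  cycle-init-chain : ∀ {K b} {cs : Fin (suc (suc K)) → Subset n} → IsCycle H b cs → IsChain (cs ∘ inject₁)
  cycle-init-chain {zero} (_ , inH , triple , _) =
    mkChain (inH ∘ inject₁) (triple ∘ inject₁) (λ { zero zero () }) (λ { zero zero () })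
  cycle-init-chain {suc _} (_ , inH , triple , _ , _ , _ , _ , three) =
    let adjacent , _ , distant = three (s≤s (s≤s (s≤s z≤n))) in
    mkChain (inH ∘ inject₁) (triple ∘ inject₁)
      (λ i j → adjacent _ _ ∘ shift-adjacent 0 toℕ-inject₁)
      (λ i j i+2≤j → distant _ _ (shift-distant 0 toℕ-inject₁ i+2≤j)
                       (λ (_ , j-last) → toℕ-inject₁-≢ j (sym (suc-injective j-last))))

  cycle-init-path : ∀ {K b} {cs : Fin (suc (suc K)) → Subset n} → IsCycle H b cs → IsPathFrom b (cs ∘ inject₁)
  cycle-init-path {b = b} {cs} cycle@(_ , _ , _ , first , _ , only , _) =
    mkPathFrom (cycle-init-chain cycle) (zero , first zero refl) b-initial
    where
    b-initial : ∀ j → b ∈ cs (inject₁ j) → toℕ j ≡ 0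
    b-initial j b∈ with only (inject₁ j) b∈
    ... | inj₁ at-first = trans (sym (toℕ-inject₁ j)) at-first
    ... | inj₂ at-last = contradiction (sym (suc-injective at-last)) (toℕ-inject₁-≢ j)

  cycle-marked-path : ∀ {L b} {cs : Fin L → Subset n} → IsCycle H b cs → MeetsMarked cs →
    ∃[ k ] Σ (Fin k → Subset n) λ qs → IsPathFrom b qs × MeetsMarked qs × (∀ v → v ∈⋃ qs → v ∈⋃ cs)
  cycle-marked-path {zero} (() , _)
  cycle-marked-path {suc zero} (s≤s () , _)
  cycle-marked-path {suc (suc K)} {cs = cs} cycle@(_ , inH , triple , _ , last , _) (i , marked∈i) with view i
  ... | ‵fromℕ =
    1 , (λ _ → cs i) , single-edge-path (inH i) (triple i) (last i (cong suc (toℕ-fromℕ _))) ,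
    (zero , marked∈i) , (λ v (_ , v∈) → i , v∈)
  ... | ‵inject₁ j =
    suc K , cs ∘ inject₁ , cycle-init-path cycle , (j , marked∈i) , (λ v (k , v∈) → inject₁ k , v∈)

  cycle-tail-chain : ∀ {K b} {cs : Fin (3 + K) → Subset n} → IsCycle H b cs → IsChain (cs ∘ suc)
  cycle-tail-chain (_ , inH , triple , _ , _ , _ , _ , three) =
    let adjacent , _ , distant = three (s≤s (s≤s (s≤s z≤n))) in
    mkChain (inH ∘ suc) (triple ∘ suc) (λ i j → adjacent _ _ ∘ cong suc)
      (λ i j i+2≤j → distant _ _ (s≤s i+2≤j) λ { (() , _) })

  cycle-first-meets-later : ∀ {K b v} {cs : Fin (3 + K) → Subset n} → IsCycle H b cs →
    ∀ j → v ∈ cs zero → v ∈ cs (suc (suc j)) → v ≡ b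
  cycle-first-meets-later {K} {v = v} (_ , _ , _ , _ , _ , _ , _ , three) j v∈first v∈ =
    let _ , ends , distant = three (s≤s (s≤s (s≤s z≤n))) in
    case 3 + toℕ j ℕ≟ 3 + K of λ where
      (yes j-last) → ends zero (suc (suc j)) refl j-last v v∈first v∈
      (no ¬j-last) → ⊥-elim (distant zero (suc (suc j)) (s≤s (s≤s z≤n)) (λ (_ , j-last) → ¬j-last j-last)
                                       (v , x∈p∩q⁺ (v∈first , v∈)))

  module _ (notTrivial : ¬ TrivialMakerWin H) where

    marked-unique : ∀ {e u v} → e ∈L edges H → ∣ e ∣ ≡ 3 → u ∈ e → v ∈ e → u ∈ M → v ∈ M → u ≡ v
    marked-unique {e} {u} {v} e∈H ∣e∣≡3 u∈e v∈e u∈M v∈M with u ≟ v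
    ... | yes u≡v = u≡v
    ... | no u≢v = contradiction (e , e∈H , ∣e─M∣≤1) notTrivial
      where
      ∣e─M∣≤1 : ∣ e ─ M ∣ ≤ 1
      ∣e─M∣≤1 = ≤-pred (≤-pred (subst (2 + ∣ e ─ M ∣ ≤_) ∣e∣≡3 (2+∣p─q∣≤∣p∣ u≢v u∈e v∈e u∈M v∈M)))

    marked-path-contains-snake : ∀ {L x} {es : Fin L → Subset n} →
      IsPathFrom x es → x ∉ M → MeetsMarked es → ContainsD₀Member x es
    marked-path-contains-snake {x = x} {es} path x∉M meets
      with least-witness (λ i → nonempty? (es i ∩ M)) meets
    ... | i , (m′ , m′∈) , unmarked-before =
      suc (toℕ i) , prefix es i , inj₁ (m′ , snake , m′∈M , only-m′) , (λ v (j , v∈) → _ , v∈)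
      where
      m′∈es : m′ ∈ es i
      m′∈es = proj₁ (x∈p∩q⁻ _ _ m′∈)
      m′∈M : m′ ∈ M
      m′∈M = proj₂ (x∈p∩q⁻ _ _ m′∈)
      unmarked : ∀ j → toℕ j < toℕ i → ∀ v → v ∈ es j → v ∉ M
      unmarked j j<i v v∈ v∈M = unmarked-before j j<i (v , x∈p∩q⁺ (v∈ , v∈M))
      snake : IsPath H x m′ (prefix es i)
      snake = prefix-path path i m′∈es (λ j j<i m′∈ → unmarked j j<i m′ m′∈ m′∈M) (λ { refl → x∉M m′∈M })
      only-m′ : ∀ v → v ∈⋃ prefix es i → v ∈ M → v ≡ m′
      only-m′ v (j , v∈) v∈M with prefix-index i j
      ... | inj₁ j<i = contradiction v∈M (unmarked _ j<i v v∈)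
      ... | inj₂ j≡i = marked-unique (inH (chain path) i) (triple (chain path) i)
                         (subst (λ k → v ∈ es k) j≡i v∈) m′∈es v∈M m′∈M

    module _ (j1 : J1D0 H) where

      J1⇒¬SeparatedAt : ∀ {K L x} {ps : Fin K → Subset n} {qs : Fin L → Subset n} → x ∉ M →
        ContainsD₀Member x ps → ContainsD₀Member x qs → ¬ SeparatedAt x ps qs
      J1⇒¬SeparatedAt x∉M (_ , ds , ds∈D₀ , ds⊆ps) (_ , es , es∈D₀ , es⊆qs) separated =
        let y , y∉M , y≢x , y∈all = j1 _ x∉M in
        [ y≢x , y∉M ] (separated y (ds⊆ps y (y∈all ds ds∈D₀)) (es⊆qs y (y∈all es es∈D₀)))

      marked-paths-not-separated : ∀ {K L x} {ps : Fin K → Subset n} {qs : Fin L → Subset n} → x ∉ M →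
        IsPathFrom x ps → MeetsMarked ps → IsPathFrom x qs → MeetsMarked qs → ¬ SeparatedAt x ps qs
      marked-paths-not-separated x∉M ps-path ps-meets qs-path qs-meets =
        J1⇒¬SeparatedAt x∉M (marked-path-contains-snake ps-path x∉M ps-meets)
                            (marked-path-contains-snake qs-path x∉M qs-meets)

      marked-fork-impossible : ∀ {L e b x} {ps : Fin L → Subset n} →
        e ∈L edges H → ∣ e ∣ ≡ 3 → b ∈ e → b ∈ M → x ∈ e → x ≢ b →
        IsPathFrom x ps → MeetsMarked ps → (∀ v → v ∈ e → v ∈⋃ ps → v ≡ x ⊎ v ≡ b) → ⊥
      marked-fork-impossible {b = b} e∈H ∣e∣≡3 b∈e b∈M x∈e x≢b path meets meet =
        marked-paths-not-separated x∉M (single-edge-path e∈H ∣e∣≡3 x∈e) (zero , b , x∈p∩q⁺ (b∈e , b∈M))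
          path meets (λ v (_ , v∈e) v∈ps → map₂ (λ { refl → b∈M }) (meet v v∈e v∈ps))
        where
        x∉M : _ ∉ M
        x∉M x∈M = x≢b (marked-unique e∈H ∣e∣≡3 x∈e b∈e x∈M b∈M)

      first-edge-fork-impossible : ∀ {K b} {es : Fin (2 + K) → Subset n} →
        es zero ∈L edges H → ∣ es zero ∣ ≡ 3 → ∣ es zero ∩ es (suc zero) ∣ ≡ 1 → IsChain (es ∘ suc) →
        b ∈ es zero → b ∈ M → b ∉ es (suc zero) → MeetsMarked (es ∘ suc) →
        (∀ j v → v ∈ es zero → v ∈ es (suc (suc j)) → v ≡ b) → ⊥
      first-edge-fork-impossible {b = b} {es} e∈H ∣e∣≡3 ∣e₀∩e₁∣≡1 tail-chain b∈e₀ b∈M b∉e₁ tail-meets later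
        with 0<∣p∣⇒Nonempty (≤-reflexive (sym ∣e₀∩e₁∣≡1))
      ... | x , x∈e₀∩e₁ =
        marked-fork-impossible e∈H ∣e∣≡3 b∈e₀ b∈M x∈e₀ x≢b
          (mkPathFrom tail-chain (zero , x∈e₁) x-initial) tail-meets meet
        where
        x∈e₀ : x ∈ es zero
        x∈e₀ = proj₁ (x∈p∩q⁻ _ _ x∈e₀∩e₁)
        x∈e₁ : x ∈ es (suc zero)
        x∈e₁ = proj₂ (x∈p∩q⁻ _ _ x∈e₀∩e₁)
        x≢b : x ≢ b
        x≢b refl = b∉e₁ x∈e₁
        x-initial : ∀ j → x ∈ es (suc j) → toℕ j ≡ 0
        x-initial zero _ = refl
        x-initial (suc j) x∈ = contradiction (later j x x∈e₀ x∈) x≢b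
        meet : ∀ v → v ∈ es zero → v ∈⋃ (es ∘ suc) → v ≡ x ⊎ v ≡ b
        meet v v∈e₀ (zero , v∈e₁) = inj₁ (∣p∣≤1⇒x≡y (≤-reflexive ∣e₀∩e₁∣≡1) (x∈p∩q⁺ (v∈e₀ , v∈e₁)) x∈e₀∩e₁)
        meet v v∈e₀ (suc j , v∈) = inj₂ (later j v v∈e₀ v∈)

      no-marked-path : ∀ {L m m′} {ps : Fin L → Subset n} → IsPath H m m′ ps → m ∈ M → m′ ∈ M → ⊥
      no-marked-path {zero} (_ , _ , _ , _ , _ , (() , _) , _)
      no-marked-path {suc zero} (inH , triple , _ , _ , m≢m′ , (zero , m∈) , _ , (zero , m′∈) , _) m∈M m′∈M =
        m≢m′ (marked-unique (inH zero) (triple zero) m∈ m′∈ m∈M m′∈M)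
      no-marked-path {suc (suc K)} {m} {m′} {ps}
        path@(inH , triple , adjacent , distant , _ , (i₀ , m∈) , initial , (iₗ , m′∈) , final) m∈M m′∈M =
        first-edge-fork-impossible {es = ps} (inH zero) (triple zero) (adjacent zero (suc zero) refl)
          (IsChain-shift 1 suc (λ _ → refl) (IsPath⇒IsChain path))
          m∈first m∈M (λ m∈ → contradiction (initial (suc zero) m∈) λ ())
          (ends-in-tail iₗ m′∈ (final iₗ m′∈))
          (λ j v v∈first v∈ → ⊥-elim (distant zero (suc (suc j)) (s≤s (s≤s z≤n)) (v , x∈p∩q⁺ (v∈first , v∈))))
        where
        m∈first : m ∈ ps zero
        m∈first = subst (λ k → m ∈ ps k) (toℕ-injective (initial i₀ m∈)) m∈
        ends-in-tail : ∀ i → m′ ∈ ps i → suc (toℕ i) ≡ 2 + K → MeetsMarked (ps ∘ suc)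
        ends-in-tail (suc j) m′∈ _ = j , m′ , x∈p∩q⁺ (m′∈ , m′∈M)

      no-marked-cycle : ∀ {L b} {cs : Fin L → Subset n} → IsCycle H b cs → b ∈ M → ⊥
      no-marked-cycle {zero} (() , _)
      no-marked-cycle {suc zero} (s≤s () , _)
      no-marked-cycle {suc (suc zero)} {b} {cs} (_ , inH , triple , first , last , _ , two , _) b∈M
        with 1<∣p∣⇒∃≢ {x = b} (≤-reflexive (sym (two refl zero (suc zero) refl refl)))
      ... | x , x∈c₀∩c₁ , x≢b =
        marked-fork-impossible {ps = λ _ → cs (suc zero)} (inH zero) (triple zero) b∈c₀ b∈M
          (proj₁ (x∈p∩q⁻ _ _ x∈c₀∩c₁)) x≢b
          (single-edge-path (inH (suc zero)) (triple (suc zero)) (proj₂ (x∈p∩q⁻ _ _ x∈c₀∩c₁)))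
          (zero , b , x∈p∩q⁺ (b∈c₁ , b∈M))
          (λ { v v∈c₀ (zero , v∈c₁) →
                 ∣p∣≤2⇒≡⊎≡ (≤-reflexive ∣c₀∩c₁∣≡2) x∈c₀∩c₁ b∈c₀∩c₁ x≢b (x∈p∩q⁺ (v∈c₀ , v∈c₁)) })
        where
        ∣c₀∩c₁∣≡2 : ∣ cs zero ∩ cs (suc zero) ∣ ≡ 2
        ∣c₀∩c₁∣≡2 = two refl zero (suc zero) refl refl
        b∈c₀ : b ∈ cs zero
        b∈c₀ = first zero refl
        b∈c₁ : b ∈ cs (suc zero)
        b∈c₁ = last (suc zero) refl
        b∈c₀∩c₁ : b ∈ cs zero ∩ cs (suc zero)
        b∈c₀∩c₁ = x∈p∩q⁺ (b∈c₀ , b∈c₁)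
      no-marked-cycle {suc (suc (suc K))} {b} {cs} cycle@(_ , inH , triple , first , last , only , _ , three) b∈M =
        first-edge-fork-impossible {es = cs} (inH zero) (triple zero) ∣c₀∩c₁∣≡1 (cycle-tail-chain cycle)
          (first zero refl) b∈M b∉c₁ b-in-tail (λ j v → cycle-first-meets-later cycle j)
        where
        ∣c₀∩c₁∣≡1 : ∣ cs zero ∩ cs (suc zero) ∣ ≡ 1
        ∣c₀∩c₁∣≡1 = proj₁ (three (s≤s (s≤s (s≤s z≤n)))) zero (suc zero) refl
        b-in-tail : MeetsMarked (cs ∘ suc)
        b-in-tail = fromℕ (suc K) , b , x∈p∩q⁺ (last _ (cong (2 +_) (toℕ-fromℕ _)) , b∈M)
        b∉c₁ : b ∉ cs (suc zero)
        b∉c₁ b∈ with only (suc zero) b∈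
        ... | inj₁ ()
        ... | inj₂ ()

      no-marked-tadpole : ∀ {K L m b} {cs : Fin L → Subset n} {ps : Fin K → Subset n} →
        IsCycle H b cs → IsPath H m b ps → m ∈ M → (∀ v → v ∈⋃ ps → v ∈⋃ cs → v ≡ b) → ⊥
      no-marked-tadpole {m = m} {b} {cs} {ps} cycle path@(_ , _ , _ , _ , _ , m-start , _) m∈M cycle∩path =
        case b ∈? M of λ where
          (yes b∈M) → no-marked-path path m∈M b∈M
          (no b∉M) → case meetsMarked? cs of λ where
            (yes cycle-meets) →
              let _ , qs , qs-path , qs-meets , qs⊆cs = cycle-marked-path cycle cycle-meets in
              marked-paths-not-separated b∉M (IsPath-reverse path) back-meets qs-path qs-meets
                (λ v v∈back v∈qs → separated v v∈back (qs⊆cs v v∈qs))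
            (no ¬cycle-meets) →
              J1⇒¬SeparatedAt b∉M (marked-path-contains-snake (IsPath-reverse path) b∉M back-meets)
                (_ , cs , inj₂ (cycle , λ v (i , v∈) v∈M → ¬cycle-meets (i , v , x∈p∩q⁺ (v∈ , v∈M))) , λ _ v∈ → v∈)
                separated
        where
        back-meets : MeetsMarked (ps ∘ opposite)
        back-meets = let i , m∈ = ⋃-reverse⁺ m-start in i , m , x∈p∩q⁺ (m∈ , m∈M)
        separated : SeparatedAt b (ps ∘ opposite) cs
        separated v (i , v∈) v∈cs = inj₁ (cycle∩path v (opposite i , v∈) v∈cs)

mainTheorem17 : ∀ {n} (H : MarkedHypergraph n) → ¬ TrivialMakerWin H → 2 ≤ ∣ ∁ (marked H) ∣ → J1D0 H → ∀ m → m ∈ marked H → ¬ ContainsTadpole H m × ¬ ContainsSnake H m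
mainTheorem17 H notTrivial _ j1 m m∈M = no-tadpole , no-snake
  where
  no-tadpole : ¬ ContainsTadpole H m
  no-tadpole (_ , _ , _ , cycle , inj₁ refl) = no-marked-cycle H notTrivial j1 cycle m∈M
  no-tadpole (_ , _ , _ , cycle , inj₂ (_ , _ , path , cycle∩path)) =
    no-marked-tadpole H notTrivial j1 cycle path m∈M cycle∩path
  no-snake : ¬ ContainsSnake H m
  no-snake (_ , m′∈M , _ , _ , path) = no-marked-path H notTrivial j1 path m∈M m′∈M
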